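{- There is an absolute constant $C$ such that for all integers $n \ge m > 0$ with $m+n\ge 4$, the complete bipartite graph $K_{m,n}$ satisfies $f(K_{m,n}) \le C\cdot \frac{n}{m}\cdot \frac{\log n}{\log(1+n/m)}$.
   Context: $\log$ is base 2. A path in a graph $G$ is a sequence of distinct vertices $v_0,\dots,v_r$ ($r\ge0$) with consecutive vertices adjacent. A vertex-separating path system of $G$ is a collection of distinct paths in $G$ such that for every pair of distinct vertices $u,v$ some path in the collection contains exactly one of $u$ and $v$. $f(G)$ denotes the minimum size of such a system. -}

module Defs where

open import Level using (0ℓ)
open import Data.Nat using (ℕ; _^_; _*_; _≤_)
open import Data.Fin using (Fin)
open import Data.Sum using (_⊎_; inj₁; inj₂)
open import Data.Product using (_×_; Σ; ∃; _,_)
open import Data.List using (List; []; _∷_; length)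
open import Data.Unit using (⊤)
open import Data.Empty using (⊥)
open import Relation.Nullary using (¬_)
open import Relation.Binary.PropositionalEquality using (_≡_; _≢_)
open import Data.List.Membership.Propositional using (_∈_; _∉_)
open import Data.List.Relation.Unary.Unique.Propositional using (Unique)
open import Data.List.Relation.Unary.Any using (Any)

record Graph : Set₁ where
  field
    V   : Set
    Adj : V → V → Set
open Graph public

data Chain (G : Graph) : List (V G) → Set where
  single : ∀ v → Chain G (v ∷ [])
  step   : ∀ {u v vs} → Adj G u v → Chain G (v ∷ vs) → Chain G (u ∷ v ∷ vs)

IsPath : (G : Graph) → List (V G) → Set
IsPath G p = Unique p × Chain G p

IsSeparatingPathSystem : (G : Graph) → List (List (V G)) → Set
IsSeparatingPathSystem G 𝒫 =
  Unique 𝒫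
  × (∀ {p} → p ∈ 𝒫 → IsPath G p)
  × (∀ (u v : V G) → u ≢ v →
       Any (λ p → (u ∈ p × v ∉ p) ⊎ (v ∈ p × u ∉ p)) 𝒫)

KAdj : ∀ {m n} → Fin m ⊎ Fin n → Fin m ⊎ Fin n → Set
KAdj (inj₁ _) (inj₁ _) = ⊥
KAdj (inj₁ _) (inj₂ _) = ⊤
KAdj (inj₂ _) (inj₁ _) = ⊤
KAdj (inj₂ _) (inj₂ _) = ⊥

K : ℕ → ℕ → Graph
K m n = record { V = Fin m ⊎ Fin n ; Adj = KAdj }

-- Write the vertices of each side of K m n in base b = 2 + ⌊n/m⌋ with D digits, where
-- b^(D-1) ≤ n ≤ b^D. For every digit position and digit value, split the vertices of one side
-- having that digit into chunks of at most s+1 vertices, s = ⌊m/2⌋; two vertices of the same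
-- side differ in some digit, so some chunk contains exactly one of them. A left chunk becomes a
-- path by interleaving it with right vertices; a right chunk Y gives two paths, interleaving Y
-- with the first resp. the last |Y|-1 left vertices. As 2s ≤ m, every left vertex misses one of
-- these two paths, which separates it from the vertices of Y. Counting chunks, the number L of
-- paths satisfies (s+1)L ≤ 3D(n + b(s+1)), hence Lm ≤ 24Dn; together with b^D ≤ n³ and
-- m + n ≤ mb this gives (m+n)^(Lm) ≤ m^(Lm) b^(Lm) ≤ m^(Lm) n^(72n).

module Submission where

open import Defs
open import Data.Bool using (true; false; if_then_else_; T)
open import Data.Empty using (⊥-elim)
open import Data.Fin using (Fin; toℕ)
import Data.Fin as Fin
open import Data.Fin.Properties using (toℕ-injective; toℕ<n)
open import Data.List using (List; []; _∷_; _++_; map; length; take; drop; filter; concatMap; upTo; allFin; deduplicate)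
import Data.List.Properties as List
open import Data.List.Properties
  using (map-cong; take++drop≡id; length-++; length-map; length-take; length-drop; length-upTo; length-tabulate; length-deduplicate)
open import Data.List.Membership.Propositional using (_∈_; _∉_; lose)
open import Data.List.Membership.Propositional.Properties
  using (∈-++⁺ˡ; ∈-++⁺ʳ; ∈-++⁻; ∈-map⁺; ∈-map⁻; ∈-filter⁺; ∈-concatMap⁺; ∈-concatMap⁻; ∈-upTo⁺; ∈-allFin; ∈-deduplicate⁺; ∈-deduplicate⁻)
open import Data.List.Relation.Binary.Disjoint.Propositional using (Disjoint)
open import Data.List.Relation.Binary.Permutation.Propositional using (_↭_; ↭-refl; prep; ↭-sym; ↭-trans; ↭⇒↭ₛ)
open import Data.List.Relation.Binary.Permutation.Propositional.Properties using (++-comm; ∈-resp-↭)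
open import Data.List.Relation.Binary.Permutation.Setoid.Properties using (Unique-resp-↭)
open import Data.List.Relation.Unary.All as All using (All)
import Data.List.Relation.Unary.All.Properties as All
open import Data.List.Relation.Unary.AllPairs using (_∷_)
open import Data.List.Relation.Unary.Any using (here; there; satisfied)
open import Data.List.Relation.Unary.Unique.Propositional using (Unique)
import Data.List.Relation.Unary.Unique.Propositional.Properties as Unique
open import Data.List.Relation.Unary.Unique.DecPropositional.Properties using (deduplicate-!)
open import Data.Nat using (ℕ; zero; suc; pred; _+_; _*_; _∸_; _^_; _⊓_; _≤_; _<_; z≤n; s≤s; NonZero; _/_; _%_; _≟_; _≡ᵇ_; _≤?_)
open import Data.Nat.DivMod using (m≡m%n+[m/n]*n; m%n<n; m<n*o⇒m/o<n; m/n*n≤m; m/n≤m; m/n<m)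
open import Data.Nat.ListAction using (sum)
open import Data.Nat.Properties
open import Algebra.Properties.CommutativeSemigroup +-commutativeSemigroup using (interchange)
open import Algebra.Properties.CommutativeSemigroup *-commutativeSemigroup using (x∙yz≈y∙xz)
open import Data.Nat.Tactic.RingSolver using (solve-∀)
open import Data.Product using (∃; ∃₂; _×_; _,_; proj₁; proj₂)
open import Data.Sum using (_⊎_; inj₁; inj₂)
import Data.Sum.Properties as Sum
open import Data.Sum.Properties using (inj₁-injective; inj₂-injective)
open import Data.Unit using (tt)
open import Function using (_∘_)
open import Relation.Binary.Definitions using (DecidableEquality)
open import Relation.Binary.PropositionalEquality
open import Relation.Nullary using (does; yes; no)

-- Interleaved lists and zigzag paths

module _ {A : Set} where

  alternate : List A → List A → List A
  alternate []       ys = ys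
  alternate (x ∷ xs) ys = x ∷ alternate ys xs

  alternate-↭ : ∀ xs ys → alternate xs ys ↭ xs ++ ys
  alternate-↭ []       ys = ↭-refl
  alternate-↭ (x ∷ xs) ys = prep x (↭-trans (alternate-↭ ys xs) (++-comm ys xs))

  ∈-alternate⁺ : ∀ {v} xs ys → v ∈ xs ⊎ v ∈ ys → v ∈ alternate xs ys
  ∈-alternate⁺ xs ys (inj₁ v∈xs) = ∈-resp-↭ (↭-sym (alternate-↭ xs ys)) (∈-++⁺ˡ v∈xs)
  ∈-alternate⁺ xs ys (inj₂ v∈ys) = ∈-resp-↭ (↭-sym (alternate-↭ xs ys)) (∈-++⁺ʳ xs v∈ys)

  ∈-alternate⁻ : ∀ {v} xs ys → v ∈ alternate xs ys → v ∈ xs ⊎ v ∈ ys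
  ∈-alternate⁻ xs ys v∈ = ∈-++⁻ xs (∈-resp-↭ (alternate-↭ xs ys) v∈)

  alternate-Unique : ∀ {xs ys} → Unique xs → Unique ys → Disjoint xs ys → Unique (alternate xs ys)
  alternate-Unique {xs} {ys} uxs uys disj =
    Unique-resp-↭ (setoid A) (↭⇒↭ₛ (↭-sym (alternate-↭ xs ys))) (Unique.++⁺ uxs uys disj)

module _ (G : Graph) where

  alternate-chain : ∀ x xs ys → length ys ≡ length xs →
                    (∀ {u v} → u ∈ x ∷ xs → v ∈ ys → Adj G u v × Adj G v u) →
                    Chain G (alternate (x ∷ xs) ys)
  alternate-chain x []        []       _  _    = single x
  alternate-chain x (x′ ∷ xs) (y ∷ ys) eq adj =
    step (proj₁ (adj (here refl) (here refl)))
         (step (proj₂ (adj (there (here refl)) (here refl)))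
               (alternate-chain x′ xs ys (suc-injective eq) λ u∈ v∈ → adj (there u∈) (there v∈)))

module Zigzag (G : Graph) {A B : Set} (ι : A → V G) (κ : B → V G)
  (ι-injective : ∀ {a a′} → ι a ≡ ι a′ → a ≡ a′)
  (κ-injective : ∀ {b b′} → κ b ≡ κ b′ → b ≡ b′)
  (ι≢κ : ∀ a b → ι a ≢ κ b)
  (ι~κ : ∀ a b → Adj G (ι a) (κ b) × Adj G (κ b) (ι a)) where

  zigzag : List A → List B → List (V G)
  zigzag as bs = alternate (map ι as) (map κ bs)

  zigzag-isPath : ∀ a as bs → Unique (a ∷ as) → Unique bs → length bs ≡ length as →
                  IsPath G (zigzag (a ∷ as) bs)
  zigzag-isPath a as bs uas ubs eq =
    alternate-Unique (Unique.map⁺ ι-injective uas) (Unique.map⁺ κ-injective ubs) disjoint ,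
    alternate-chain G (ι a) (map ι as) (map κ bs) (trans (length-map κ bs) (trans eq (sym (length-map ι as)))) adjacent
    where
      disjoint : Disjoint (map ι (a ∷ as)) (map κ bs)
      disjoint (u∈ , v∈) with ∈-map⁻ ι u∈ | ∈-map⁻ κ v∈
      ... | a′ , _ , refl | b′ , _ , eq′ = ι≢κ a′ b′ eq′
      adjacent : ∀ {u v} → u ∈ map ι (a ∷ as) → v ∈ map κ bs → Adj G u v × Adj G v u
      adjacent u∈ v∈ with ∈-map⁻ ι u∈ | ∈-map⁻ κ v∈
      ... | a′ , _ , refl | b′ , _ , refl = ι~κ a′ b′

  ι∈zigzag⁺ : ∀ {a as} bs → a ∈ as → ι a ∈ zigzag as bs
  ι∈zigzag⁺ {as = as} bs a∈ = ∈-alternate⁺ (map ι as) (map κ bs) (inj₁ (∈-map⁺ ι a∈))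

  ι∈zigzag⁻ : ∀ {a} as bs → ι a ∈ zigzag as bs → a ∈ as
  ι∈zigzag⁻ as bs ιa∈ with ∈-alternate⁻ (map ι as) (map κ bs) ιa∈
  ... | inj₁ ιa∈ι with ∈-map⁻ ι ιa∈ι
  ...   | a′ , a′∈ , eq rewrite ι-injective eq = a′∈
  ι∈zigzag⁻ as bs ιa∈ | inj₂ ιa∈κ with ∈-map⁻ κ ιa∈κ
  ...   | b′ , _ , eq = ⊥-elim (ι≢κ _ b′ eq)

  κ∈zigzag⁻ : ∀ {b} as bs → κ b ∈ zigzag as bs → b ∈ bs
  κ∈zigzag⁻ as bs κb∈ with ∈-alternate⁻ (map ι as) (map κ bs) κb∈
  ... | inj₂ κb∈κ with ∈-map⁻ κ κb∈κ
  ...   | b′ , b′∈ , eq rewrite κ-injective eq = b′∈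
  κ∈zigzag⁻ as bs κb∈ | inj₁ κb∈ι with ∈-map⁻ ι κb∈ι
  ...   | a′ , _ , eq = ⊥-elim (ι≢κ a′ _ (sym eq))

Separates : ∀ {A : Set} → A → A → List A → Set
Separates u v p = (u ∈ p × v ∉ p) ⊎ (v ∈ p × u ∉ p)

separatingPaths⇒separatingPathSystem :
  ∀ (G : Graph) → DecidableEquality (V G) → ∀ 𝒫 →
  (∀ {p} → p ∈ 𝒫 → IsPath G p) → (∀ u v → u ≢ v → ∃ λ p → p ∈ 𝒫 × Separates u v p) →
  ∃ λ 𝒬 → IsSeparatingPathSystem G 𝒬 × length 𝒬 ≤ length 𝒫
separatingPaths⇒separatingPathSystem G _≟_ 𝒫 paths separate =
  deduplicate _≡?_ 𝒫 ,
  (deduplicate-! _≡?_ 𝒫 ,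
   (λ p∈ → paths (∈-deduplicate⁻ _≡?_ 𝒫 p∈)) ,
   (λ u v u≢v → let p , p∈ , sep = separate u v u≢v in lose (∈-deduplicate⁺ _≡?_ p∈) sep)) ,
  length-deduplicate _≡?_ 𝒫
  where
    _≡?_ : DecidableEquality (List (V G))
    _≡?_ = List.≡-dec _≟_

-- Counting

module _ {A : Set} where

  sum-map-+ : ∀ (f g : A → ℕ) xs → sum (map (λ x → f x + g x) xs) ≡ sum (map f xs) + sum (map g xs)
  sum-map-+ f g []       = refl
  sum-map-+ f g (x ∷ xs) = trans (cong (f x + g x +_) (sum-map-+ f g xs)) (interchange (f x) (g x) _ _)

  sum-map-const : ∀ k (xs : List A) → sum (map (λ _ → k) xs) ≡ length xs * k
  sum-map-const k []       = refl
  sum-map-const k (x ∷ xs) = cong (k +_) (sum-map-const k xs)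

  *-length-concatMap≤ : ∀ {B : Set} w (f : A → List B) (g : A → ℕ) → (∀ x → w * length (f x) ≤ g x) →
                        ∀ xs → w * length (concatMap f xs) ≤ sum (map g xs)
  *-length-concatMap≤ w f g bound []       = ≤-reflexive (*-zeroʳ w)
  *-length-concatMap≤ w f g bound (x ∷ xs) = begin
    w * length (f x ++ concatMap f xs)             ≡⟨ cong (w *_) (length-++ (f x)) ⟩
    w * (length (f x) + length (concatMap f xs))   ≡⟨ *-distribˡ-+ w (length (f x)) _ ⟩
    w * length (f x) + w * length (concatMap f xs) ≤⟨ +-mono-≤ (bound x) (*-length-concatMap≤ w f g bound xs) ⟩
    g x + sum (map g xs)                           ∎
    where open ≤-Reasoning

δ : ℕ → ℕ → ℕ
δ a c = if a ≡ᵇ c then 1 else 0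

≡ᵇ≡true⇒≡ : ∀ a c → (a ≡ᵇ c) ≡ true → a ≡ c
≡ᵇ≡true⇒≡ a c a≡ᵇc = ≡ᵇ⇒≡ a c (subst T (sym a≡ᵇc) tt)

sum-δ≡0 : ∀ a cs → a ∉ cs → sum (map (δ a) cs) ≡ 0
sum-δ≡0 a []       a∉ = refl
sum-δ≡0 a (c ∷ cs) a∉ with a ≡ᵇ c in a≡ᵇc
... | true  = ⊥-elim (a∉ (here (≡ᵇ≡true⇒≡ a c a≡ᵇc)))
... | false = sum-δ≡0 a cs (a∉ ∘ there)

sum-δ≤1 : ∀ a {cs} → Unique cs → sum (map (δ a) cs) ≤ 1
sum-δ≤1 a {[]}     _           = z≤n
sum-δ≤1 a {c ∷ cs} (c∉ ∷ ucs) with a ≡ᵇ c in a≡ᵇc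
... | true  = ≤-reflexive (cong suc (sum-δ≡0 a cs (λ a∈ → All.lookup c∉ a∈ (sym (≡ᵇ≡true⇒≡ a c a≡ᵇc)))))
... | false = sum-δ≤1 a ucs

module _ {A : Set} (key : A → ℕ) where

  fibre : ℕ → List A → List A
  fibre c = filter (λ x → key x ≟ c)

  length-fibre-∷ : ∀ c x xs → length (fibre c (x ∷ xs)) ≡ δ (key x) c + length (fibre c xs)
  length-fibre-∷ c x xs with does (key x ≟ c)
  ... | true  = refl
  ... | false = refl

  sum-length-fibre≤ : ∀ {cs} → Unique cs → ∀ xs → sum (map (λ c → length (fibre c xs)) cs) ≤ length xs
  sum-length-fibre≤ {cs} ucs []       = ≤-reflexive (trans (sum-map-const 0 cs) (*-zeroʳ (length cs)))
  sum-length-fibre≤ {cs} ucs (x ∷ xs) = begin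
    sum (map (λ c → length (fibre c (x ∷ xs))) cs)             ≡⟨ cong sum (map-cong (λ c → length-fibre-∷ c x xs) cs) ⟩
    sum (map (λ c → δ (key x) c + length (fibre c xs)) cs)     ≡⟨ sum-map-+ (δ (key x)) (λ c → length (fibre c xs)) cs ⟩
    sum (map (δ (key x)) cs) + sum (map (λ c → length (fibre c xs)) cs) ≤⟨ +-mono-≤ (sum-δ≤1 (key x) ucs) (sum-length-fibre≤ ucs xs) ⟩
    suc (length xs)                                            ∎
    where open ≤-Reasoning

-- Chunks and digit blocks

Chunk : ∀ {A : Set} → ℕ → List A → Set
Chunk s Y = ∃₂ λ y ys → Y ≡ y ∷ ys × length ys ≤ s

module _ {A : Set} (s : ℕ) where

  chunks : ℕ → List A → List (List A)
  chunks zero    _        = []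
  chunks (suc k) []       = []
  chunks (suc k) (x ∷ xs) = (x ∷ take s xs) ∷ chunks k (drop s xs)

  chunksOf : List A → List (List A)
  chunksOf xs = chunks (length xs) xs

  ∈-chunks⇒Chunk : ∀ k xs {Y} → Y ∈ chunks k xs → Chunk s Y
  ∈-chunks⇒Chunk (suc k) (x ∷ xs) (here refl) = x , take s xs , refl , ≤-trans (≤-reflexive (length-take s xs)) (m⊓n≤m s _)
  ∈-chunks⇒Chunk (suc k) (x ∷ xs) (there Y∈) = ∈-chunks⇒Chunk k (drop s xs) Y∈

  ∈-chunks⇒Unique : ∀ k {xs Y} → Unique xs → Y ∈ chunks k xs → Unique Y
  ∈-chunks⇒Unique (suc k) {x ∷ xs} uxs (here refl) = Unique.take⁺ (suc s) uxs
  ∈-chunks⇒Unique (suc k) {x ∷ xs} uxs (there Y∈) = ∈-chunks⇒Unique k (Unique.drop⁺ (suc s) uxs) Y∈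

  ∈-chunks⇒All : ∀ {P : A → Set} k {xs Y} → All P xs → Y ∈ chunks k xs → All P Y
  ∈-chunks⇒All (suc k) {x ∷ xs} pxs (here refl) = All.take⁺ (suc s) pxs
  ∈-chunks⇒All (suc k) {x ∷ xs} pxs (there Y∈) = ∈-chunks⇒All k (All.drop⁺ (suc s) pxs) Y∈

  chunks-cover : ∀ k {xs z} → length xs ≤ k → z ∈ xs → ∃ λ Y → Y ∈ chunks k xs × z ∈ Y
  chunks-cover (suc k) {x ∷ xs} _          (here refl) = _ , here refl , here refl
  chunks-cover (suc k) {x ∷ xs} (s≤s |xs|≤k) (there z∈) with ∈-++⁻ (take s xs) (subst (_ ∈_) (sym (take++drop≡id s xs)) z∈)
  ... | inj₁ z∈take = _ , here refl , there z∈take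
  ... | inj₂ z∈drop with chunks-cover k (≤-trans (≤-reflexive (length-drop s xs)) (≤-trans (m∸n≤m _ s) |xs|≤k)) z∈drop
  ...   | Y , Y∈ , z∈Y = Y , there Y∈ , z∈Y

  chunks-[] : ∀ k → chunks k [] ≡ []
  chunks-[] zero    = refl
  chunks-[] (suc k) = refl

  -- all chunks but the last one are full
  *-length-chunks≤ : ∀ k xs → suc s * length (chunks k xs) ≤ length xs + suc s
  *-length-chunks≤ zero    xs = ≤-trans (≤-reflexive (*-zeroʳ (suc s))) z≤n
  *-length-chunks≤ (suc k) [] = ≤-trans (≤-reflexive (*-zeroʳ (suc s))) z≤n
  *-length-chunks≤ (suc k) (x ∷ xs) with drop s xs in drop≡
  ... | [] rewrite chunks-[] k = ≤-trans (≤-reflexive (*-identityʳ (suc s))) (m≤n+m (suc s) (suc (length xs)))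
  ... | y ∷ ys = begin
    suc s * suc c                          ≡⟨ *-suc (suc s) c ⟩
    suc s + suc s * c                      ≤⟨ +-monoʳ-≤ (suc s) (*-length-chunks≤ k (y ∷ ys)) ⟩
    suc s + (length (y ∷ ys) + suc s)      ≡⟨ cong (λ l → suc s + (l + suc s)) |rest| ⟩
    suc s + (length xs ∸ s + suc s)        ≡⟨ sym (+-assoc (suc s) _ (suc s)) ⟩
    suc (s + (length xs ∸ s)) + suc s      ≡⟨ cong (λ l → suc l + suc s) (m+[n∸m]≡n s≤|xs|) ⟩
    suc (length xs) + suc s                ∎
    where
      open ≤-Reasoning
      c = length (chunks k (y ∷ ys))
      |rest| : length (y ∷ ys) ≡ length xs ∸ s
      |rest| = trans (cong length (sym drop≡)) (length-drop s xs)
      s≤|xs| : s ≤ length xs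
      s≤|xs| = <⇒≤ (m∸n≢0⇒n<m λ |xs|∸s≡0 → 0≢1+n (trans (sym |xs|∸s≡0) (sym |rest|)))

module Blocks {A : Set} (b : ℕ) (digit : ℕ → A → ℕ) (s D : ℕ) (xs : List A) where

  class : ℕ → ℕ → List A
  class t c = fibre (digit t) c xs

  -- opaque: otherwise `with` over a proof of Y ∈ blocks normalises the whole family, which is very slow
  opaque
    blocks : List (List A)
    blocks = concatMap (λ t → concatMap (λ c → chunksOf s (class t c)) (upTo b)) (upTo D)

    ∈-blocks⁻ : ∀ {Y} → Y ∈ blocks → ∃₂ λ t c → Y ∈ chunksOf s (class t c)
    ∈-blocks⁻ Y∈ with satisfied (∈-concatMap⁻ _ {xs = upTo D} Y∈)
    ... | t , Y∈t with satisfied (∈-concatMap⁻ _ {xs = upTo b} Y∈t)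
    ...   | c , Y∈tc = t , c , Y∈tc

    blocks-∋ : ∀ {x t} → x ∈ xs → t < D → digit t x < b →
               ∃ λ Y → Y ∈ blocks × x ∈ Y × All (λ y → digit t y ≡ digit t x) Y
    blocks-∋ {x} {t} x∈ t<D dx<b with chunks-cover s _ ≤-refl (∈-filter⁺ (λ y → digit t y ≟ digit t x) x∈ refl)
    ... | Y , Y∈ , x∈Y =
      Y , ∈-concatMap⁺ _ (lose (∈-upTo⁺ t<D) (∈-concatMap⁺ _ (lose (∈-upTo⁺ dx<b) Y∈))) , x∈Y ,
      ∈-chunks⇒All s _ (All.all-filter (λ y → digit t y ≟ digit t x) xs) Y∈

    *-length-blocks≤ : suc s * length blocks ≤ D * (length xs + b * suc s)
    *-length-blocks≤ = begin
      suc s * length blocks                           ≤⟨ *-length-concatMap≤ (suc s) _ (λ _ → length xs + b * suc s) perDigit (upTo D) ⟩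
      sum (map (λ _ → length xs + b * suc s) (upTo D)) ≡⟨ sum-map-const _ (upTo D) ⟩
      length (upTo D) * (length xs + b * suc s)        ≡⟨ cong (_* _) (length-upTo D) ⟩
      D * (length xs + b * suc s)                      ∎
      where
        open ≤-Reasoning
        perDigit : ∀ t → suc s * length (concatMap (λ c → chunksOf s (class t c)) (upTo b)) ≤ length xs + b * suc s
        perDigit t = begin
          suc s * length (concatMap (λ c → chunksOf s (class t c)) (upTo b))
            ≤⟨ *-length-concatMap≤ (suc s) _ (λ c → length (class t c) + suc s) (λ c → *-length-chunks≤ s (length (class t c)) (class t c)) (upTo b) ⟩
          sum (map (λ c → length (class t c) + suc s) (upTo b))
            ≡⟨ sum-map-+ (λ c → length (class t c)) (λ _ → suc s) (upTo b) ⟩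
          sum (map (λ c → length (class t c)) (upTo b)) + sum (map (λ _ → suc s) (upTo b))
            ≤⟨ +-mono-≤ (sum-length-fibre≤ (digit t) (Unique.upTo⁺ b) xs)
                        (≤-reflexive (trans (sum-map-const (suc s) (upTo b)) (cong (_* suc s) (length-upTo b)))) ⟩
          length xs + b * suc s ∎

  block-Chunk : ∀ {Y} → Y ∈ blocks → Chunk s Y
  block-Chunk Y∈ with ∈-blocks⁻ Y∈
  ... | t , c , Y∈tc = ∈-chunks⇒Chunk s _ _ Y∈tc

  block-Unique : Unique xs → ∀ {Y} → Y ∈ blocks → Unique Y
  block-Unique uxs Y∈ with ∈-blocks⁻ Y∈
  ... | t , c , Y∈tc = ∈-chunks⇒Unique s _ (Unique.filter⁺ _ uxs) Y∈tc

module _ (b : ℕ) .{{_ : NonZero b}} where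

  digit : ℕ → ℕ → ℕ
  digit zero    x = x % b
  digit (suc t) x = digit t (x / b)

  digit<base : ∀ t x → digit t x < b
  digit<base zero    x = m%n<n x b
  digit<base (suc t) x = digit<base t (x / b)

  digits-distinguish : ∀ D {x y} → x < b ^ D → y < b ^ D → x ≢ y → ∃ λ t → t < D × digit t x ≢ digit t y
  digits-distinguish zero {zero} {zero} _ _ x≢y = ⊥-elim (x≢y refl)
  digits-distinguish zero {suc x} (s≤s ()) _
  digits-distinguish zero {_} {suc y} _ (s≤s ())
  digits-distinguish (suc D) {x} {y} x< y< x≢y with x % b ≟ y % b
  ... | no  x%b≢y%b = zero , s≤s z≤n , x%b≢y%b
  ... | yes x%b≡y%b with digits-distinguish D (quotient< x<) (quotient< y<) quotients≢
    where
      quotient< : ∀ {z} → z < b ^ suc D → z / b < b ^ D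
      quotient< {z} z< = m<n*o⇒m/o<n (subst (z <_) (*-comm b (b ^ D)) z<)
      quotients≢ : x / b ≢ y / b
      quotients≢ x/b≡y/b = x≢y (begin
        x                   ≡⟨ m≡m%n+[m/n]*n x b ⟩
        x % b + (x / b) * b ≡⟨ cong₂ (λ r q → r + q * b) x%b≡y%b x/b≡y/b ⟩
        y % b + (y / b) * b ≡⟨ m≡m%n+[m/n]*n y b ⟨
        y                   ∎)
        where open ≡-Reasoning
  ...   | t , t<D , digits≢ = suc t , s≤s t<D , digits≢

length-allFin : ∀ k → length (allFin k) ≡ k
length-allFin k = length-tabulate {n = k} (λ i → i)

module FinBlocks (b : ℕ) .{{_ : NonZero b}} (s D k : ℕ) where

  open Blocks b (λ t i → digit b t (toℕ i)) s D (allFin k) public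

  blocks-separate : k ≤ b ^ D → ∀ i i′ → i ≢ i′ → ∃ λ Y → Y ∈ blocks × i ∈ Y × i′ ∉ Y
  blocks-separate k≤b^D i i′ i≢i′
    with digits-distinguish b D (≤-trans (toℕ<n i) k≤b^D) (≤-trans (toℕ<n i′) k≤b^D) (i≢i′ ∘ toℕ-injective)
  ... | t , t<D , digits≢ with blocks-∋ (∈-allFin i) t<D (digit<base b t (toℕ i))
  ...   | Y , Y∈ , i∈Y , sameDigit = Y , Y∈ , i∈Y , λ i′∈Y → digits≢ (sym (All.lookup sameDigit i′∈Y))

  blocks-cover : 0 < D → ∀ i → ∃ λ Y → Y ∈ blocks × i ∈ Y
  blocks-cover 0<D i with blocks-∋ (∈-allFin i) 0<D (digit<base b 0 (toℕ i))
  ... | Y , Y∈ , i∈Y , _ = Y , Y∈ , i∈Y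

  *-length-finBlocks≤ : suc s * length blocks ≤ D * (k + b * suc s)
  *-length-finBlocks≤ = subst (λ l → suc s * length blocks ≤ D * (l + b * suc s)) (length-allFin k) *-length-blocks≤

-- The path system of K m n

∈-drop⁻ : ∀ {A : Set} n (zs : List A) {z} → z ∈ drop n zs → z ∈ zs
∈-drop⁻ zero    zs       z∈ = z∈
∈-drop⁻ (suc n) (x ∷ zs) z∈ = there (∈-drop⁻ n zs z∈)

take-disjoint-drop : ∀ {A : Set} {a a′} {zs : List A} {z} → a ≤ a′ → Unique zs → z ∈ take a zs → z ∉ drop a′ zs
take-disjoint-drop {a = suc a} {suc a′} {x ∷ zs} _ (x∉ ∷ _) (here refl) z∈drop = All.lookup x∉ (∈-drop⁻ a′ zs z∈drop) refl
take-disjoint-drop {a = suc a} {suc a′} {x ∷ zs} (s≤s a≤a′) (_ ∷ uzs) (there z∈take) = take-disjoint-drop a≤a′ uzs z∈take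

length-take-allFin : ∀ {j k} → j ≤ k → length (take j (allFin k)) ≡ j
length-take-allFin {j} {k} j≤k = trans (length-take j (allFin k)) (trans (cong (j ⊓_) (length-allFin k)) (m≤n⇒m⊓n≡m j≤k))

length-drop-allFin : ∀ {j} k → j ≤ k → length (drop (k ∸ j) (allFin k)) ≡ j
length-drop-allFin {j} k j≤k = trans (length-drop (k ∸ j) (allFin k)) (trans (cong (_∸ (k ∸ j)) (length-allFin k)) (m∸[m∸n]≡n j≤k))

module Construction (m n b : ℕ) .{{_ : NonZero b}} (s D : ℕ)
  (s+s≤m : s + s ≤ m) (m≤n : m ≤ n) (n≤b^D : n ≤ b ^ D) (0<D : 0 < D) where

  open import Data.List.Membership.DecPropositional (Fin._≟_ {m}) using (_∈?_)

  Vertex : Set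
  Vertex = Fin m ⊎ Fin n

  module Left  = Zigzag (K m n) inj₁ inj₂ inj₁-injective inj₂-injective (λ _ _ ()) (λ _ _ → tt , tt)
  module Right = Zigzag (K m n) inj₂ inj₁ inj₂-injective inj₁-injective (λ _ _ ()) (λ _ _ → tt , tt)
  module A = FinBlocks b s D m
  module B = FinBlocks b s D n

  leftPath : List (Fin m) → List Vertex
  leftPath X = Left.zigzag X (take (pred (length X)) (allFin n))

  rightPath₁ rightPath₂ : List (Fin n) → List Vertex
  rightPath₁ Y = Right.zigzag Y (take (pred (length Y)) (allFin m))
  rightPath₂ Y = Right.zigzag Y (drop (m ∸ pred (length Y)) (allFin m))

  paths : List (List Vertex)
  paths = map leftPath A.blocks ++ map rightPath₁ B.blocks ++ map rightPath₂ B.blocks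

  s≤m : s ≤ m
  s≤m = ≤-trans (m≤m+n s s) s+s≤m

  leftPath-isPath : ∀ {X} → Unique X → Chunk s X → IsPath (K m n) (leftPath X)
  leftPath-isPath uX (x , xs , refl , |xs|≤s) =
    Left.zigzag-isPath x xs _ uX (Unique.take⁺ _ (Unique.allFin⁺ n)) (length-take-allFin (≤-trans |xs|≤s (≤-trans s≤m m≤n)))

  rightPath₁-isPath : ∀ {Y} → Unique Y → Chunk s Y → IsPath (K m n) (rightPath₁ Y)
  rightPath₁-isPath uY (y , ys , refl , |ys|≤s) =
    Right.zigzag-isPath y ys _ uY (Unique.take⁺ _ (Unique.allFin⁺ m)) (length-take-allFin (≤-trans |ys|≤s s≤m))

  rightPath₂-isPath : ∀ {Y} → Unique Y → Chunk s Y → IsPath (K m n) (rightPath₂ Y)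
  rightPath₂-isPath uY (y , ys , refl , |ys|≤s) =
    Right.zigzag-isPath y ys _ uY (Unique.drop⁺ (m ∸ length ys) (Unique.allFin⁺ m)) (length-drop-allFin m (≤-trans |ys|≤s s≤m))

  paths-isPath : ∀ {p} → p ∈ paths → IsPath (K m n) p
  paths-isPath p∈ with ∈-++⁻ (map leftPath A.blocks) p∈
  ... | inj₁ p∈L with ∈-map⁻ leftPath p∈L
  ...   | X , X∈ , refl = leftPath-isPath (A.block-Unique (Unique.allFin⁺ m) X∈) (A.block-Chunk X∈)
  paths-isPath p∈ | inj₂ p∈R with ∈-++⁻ (map rightPath₁ B.blocks) p∈R
  ... | inj₁ p∈R₁ with ∈-map⁻ rightPath₁ p∈R₁
  ...   | Y , Y∈ , refl = rightPath₁-isPath (B.block-Unique (Unique.allFin⁺ n) Y∈) (B.block-Chunk Y∈)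
  paths-isPath p∈ | inj₂ p∈R | inj₂ p∈R₂ with ∈-map⁻ rightPath₂ p∈R₂
  ...   | Y , Y∈ , refl = rightPath₂-isPath (B.block-Unique (Unique.allFin⁺ n) Y∈) (B.block-Chunk Y∈)

  leftPath∈paths : ∀ {X} → X ∈ A.blocks → leftPath X ∈ paths
  leftPath∈paths X∈ = ∈-++⁺ˡ (∈-map⁺ leftPath X∈)

  rightPath₁∈paths : ∀ {Y} → Y ∈ B.blocks → rightPath₁ Y ∈ paths
  rightPath₁∈paths Y∈ = ∈-++⁺ʳ (map leftPath A.blocks) (∈-++⁺ˡ (∈-map⁺ rightPath₁ Y∈))

  rightPath₂∈paths : ∀ {Y} → Y ∈ B.blocks → rightPath₂ Y ∈ paths
  rightPath₂∈paths Y∈ = ∈-++⁺ʳ (map leftPath A.blocks) (∈-++⁺ʳ (map rightPath₁ B.blocks) (∈-map⁺ rightPath₂ Y∈))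

  rightPaths-avoid : ∀ {Y} → Chunk s Y → ∀ i → inj₁ i ∉ rightPath₁ Y ⊎ inj₁ i ∉ rightPath₂ Y
  rightPaths-avoid (y , ys , refl , |ys|≤s) i with i ∈? take (length ys) (allFin m)
  ... | yes i∈take = inj₂ (take-disjoint-drop disjoint (Unique.allFin⁺ m) i∈take ∘ Right.κ∈zigzag⁻ (y ∷ ys) (drop (m ∸ length ys) (allFin m)))
    where
      disjoint : length ys ≤ m ∸ length ys
      disjoint = m+n≤o⇒m≤o∸n (length ys) (≤-trans (+-mono-≤ |ys|≤s |ys|≤s) s+s≤m)
  ... | no  i∉take = inj₁ (i∉take ∘ Right.κ∈zigzag⁻ (y ∷ ys) (take (length ys) (allFin m)))

  separate-left-right : ∀ i j → ∃ λ p → p ∈ paths × Separates (inj₂ j) (inj₁ i) p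
  separate-left-right i j using Y , Y∈ , j∈Y ← B.blocks-cover 0<D j
    with rightPaths-avoid (B.block-Chunk Y∈) i
  ... | inj₁ i∉p = rightPath₁ Y , rightPath₁∈paths Y∈ , inj₁ (Right.ι∈zigzag⁺ _ j∈Y , i∉p)
  ... | inj₂ i∉p = rightPath₂ Y , rightPath₂∈paths Y∈ , inj₁ (Right.ι∈zigzag⁺ _ j∈Y , i∉p)

  separate : ∀ u v → u ≢ v → ∃ λ p → p ∈ paths × Separates u v p
  separate (inj₁ i) (inj₁ i′) i≢i′ with A.blocks-separate (≤-trans m≤n n≤b^D) i i′ (i≢i′ ∘ cong inj₁)
  ... | X , X∈ , i∈X , i′∉X = leftPath X , leftPath∈paths X∈ , inj₁ (Left.ι∈zigzag⁺ _ i∈X , i′∉X ∘ Left.ι∈zigzag⁻ X _)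
  separate (inj₂ j) (inj₂ j′) j≢j′ with B.blocks-separate n≤b^D j j′ (j≢j′ ∘ cong inj₂)
  ... | Y , Y∈ , j∈Y , j′∉Y = rightPath₁ Y , rightPath₁∈paths Y∈ , inj₁ (Right.ι∈zigzag⁺ _ j∈Y , j′∉Y ∘ Right.ι∈zigzag⁻ Y _)
  separate (inj₁ i) (inj₂ j) _ with separate-left-right i j
  ... | p , p∈ , inj₁ sep = p , p∈ , inj₂ sep
  ... | p , p∈ , inj₂ sep = p , p∈ , inj₁ sep
  separate (inj₂ j) (inj₁ i) _ = separate-left-right i j

  length-paths : length paths ≡ length A.blocks + 2 * length B.blocks
  length-paths = begin
    length paths
      ≡⟨ length-++ (map leftPath A.blocks) ⟩
    length (map leftPath A.blocks) + length (map rightPath₁ B.blocks ++ map rightPath₂ B.blocks)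
      ≡⟨ cong (length (map leftPath A.blocks) +_) (length-++ (map rightPath₁ B.blocks)) ⟩
    length (map leftPath A.blocks) + (length (map rightPath₁ B.blocks) + length (map rightPath₂ B.blocks))
      ≡⟨ cong₂ _+_ (length-map leftPath A.blocks)
                   (cong₂ _+_ (length-map rightPath₁ B.blocks) (trans (length-map rightPath₂ B.blocks) (sym (+-identityʳ _)))) ⟩
    length A.blocks + 2 * length B.blocks
      ∎
    where open ≡-Reasoning

  *-length-paths≤ : suc s * length paths ≤ D * (m + b * suc s) + 2 * (D * (n + b * suc s))
  *-length-paths≤ = begin
    suc s * length paths                                         ≡⟨ cong (suc s *_) length-paths ⟩
    suc s * (length A.blocks + 2 * length B.blocks)              ≡⟨ *-distribˡ-+ (suc s) (length A.blocks) _ ⟩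
    suc s * length A.blocks + suc s * (2 * length B.blocks)      ≡⟨ cong (suc s * length A.blocks +_) (x∙yz≈y∙xz (suc s) 2 (length B.blocks)) ⟩
    suc s * length A.blocks + 2 * (suc s * length B.blocks)      ≤⟨ +-mono-≤ A.*-length-finBlocks≤ (*-monoʳ-≤ 2 B.*-length-finBlocks≤) ⟩
    D * (m + b * suc s) + 2 * (D * (n + b * suc s))              ∎
    where open ≤-Reasoning

  separatingPathSystem : ∃ λ 𝒫 → IsSeparatingPathSystem (K m n) 𝒫 ×
                                 suc s * length 𝒫 ≤ D * (m + b * suc s) + 2 * (D * (n + b * suc s))
  separatingPathSystem
    with 𝒫 , system , |𝒫|≤ ← separatingPaths⇒separatingPathSystem (K m n) (Sum.≡-dec Fin._≟_ Fin._≟_) paths paths-isPath separate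
    = 𝒫 , system , ≤-trans (*-monoʳ-≤ (suc s) |𝒫|≤) *-length-paths≤

-- Arithmetic

^-distribʳ-* : ∀ a c e → (a * c) ^ e ≡ a ^ e * c ^ e
^-distribʳ-* a c zero    = refl
^-distribʳ-* a c (suc e) = trans (cong (a * c *_) (^-distribʳ-* a c e)) (rearrange a c (a ^ e) (c ^ e))
  where
    rearrange : ∀ a b x y → a * b * (x * y) ≡ a * x * (b * y)
    rearrange = solve-∀

power-bracket : ∀ b → 2 ≤ b → ∀ n .{{_ : NonZero n}} → ∃ λ e → b ^ e ≤ n × n ≤ b ^ suc e
power-bracket b 2≤b 1 = 0 , ≤-refl , ≤-trans (≤-trans (s≤s z≤n) 2≤b) (≤-reflexive (sym (*-identityʳ b)))
power-bracket b 2≤b (suc (suc n)) with power-bracket b 2≤b (suc n)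
... | e , lower , upper with suc (suc n) ≤? b ^ suc e
...   | yes n+2≤ = e , m≤n⇒m≤1+n lower , n+2≤
...   | no  n+2≰ = suc e , <⇒≤ (≰⇒> n+2≰) , upper′
  where
    open ≤-Reasoning
    upper′ : suc (suc n) ≤ b ^ suc (suc e)
    upper′ = begin
      suc (suc n)             ≤⟨ s≤s upper ⟩
      suc (b ^ suc e)         ≤⟨ +-monoˡ-≤ (b ^ suc e) (≤-trans (s≤s z≤n) upper) ⟩
      b ^ suc e + b ^ suc e   ≡⟨ cong (b ^ suc e +_) (+-identityʳ (b ^ suc e)) ⟨
      2 * b ^ suc e           ≤⟨ *-monoˡ-≤ (b ^ suc e) 2≤b ⟩
      b ^ suc (suc e)         ∎

m/2+m/2≤m : ∀ m → m / 2 + m / 2 ≤ m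
m/2+m/2≤m m = ≤-trans (≤-reflexive (trans (cong (m / 2 +_) (sym (+-identityʳ (m / 2)))) (*-comm 2 (m / 2)))) (m/n*n≤m m 2)

2+n≤n*n : ∀ {n} → 2 ≤ n → 2 + n ≤ n * n
2+n≤n*n {suc zero} (s≤s ())
2+n≤n*n {suc (suc k)} _ = ≤-trans (m≤m+n (4 + k) (k * (2 + k) + k)) (≤-reflexive (expand k))
  where
    expand : ∀ k → 4 + k + (k * (2 + k) + k) ≡ (2 + k) * (2 + k)
    expand = solve-∀

1+m/2≤m : ∀ m .{{_ : NonZero m}} → suc (m / 2) ≤ m
1+m/2≤m m = m/n<m m 2 (s≤s (s≤s z≤n))

m≤2*[1+m/2] : ∀ m → m ≤ 2 * suc (m / 2)
m≤2*[1+m/2] m = begin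
  m                   ≡⟨ m≡m%n+[m/n]*n m 2 ⟩
  m % 2 + m / 2 * 2   ≤⟨ +-monoˡ-≤ (m / 2 * 2) (<⇒≤ (m%n<n m 2)) ⟩
  2 + m / 2 * 2       ≡⟨ rearrange (m / 2) ⟩
  2 * suc (m / 2)     ∎
  where
    open ≤-Reasoning
    rearrange : ∀ h → 2 + h * 2 ≡ 2 * suc h
    rearrange = solve-∀

module _ (m n : ℕ) .{{_ : NonZero m}} where

  m+n≤m*[2+n/m] : m + n ≤ m * (2 + n / m)
  m+n≤m*[2+n/m] = begin
    m + n                   ≡⟨ cong (m +_) (m≡m%n+[m/n]*n n m) ⟩
    m + (n % m + n / m * m) ≤⟨ +-monoʳ-≤ m (+-monoˡ-≤ (n / m * m) (<⇒≤ (m%n<n n m))) ⟩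
    m + (m + n / m * m)     ≡⟨ rearrange m (n / m) ⟩
    m * (2 + n / m)         ∎
    where
      open ≤-Reasoning
      rearrange : ∀ m q → m + (m + q * m) ≡ m * (2 + q)
      rearrange = solve-∀

  [2+n/m]*m≤3n : m ≤ n → (2 + n / m) * m ≤ 3 * n
  [2+n/m]*m≤3n m≤n = begin
    (2 + n / m) * m     ≡⟨ rearrange m (n / m) ⟩
    m + m + n / m * m   ≤⟨ +-mono-≤ (+-mono-≤ m≤n m≤n) (m/n*n≤m n m) ⟩
    n + n + n           ≡⟨ rearrange′ n ⟩
    3 * n               ∎
    where
      open ≤-Reasoning
      rearrange : ∀ m q → (2 + q) * m ≡ m + m + q * m
      rearrange = solve-∀
      rearrange′ : ∀ n → n + n + n ≡ 3 * n
      rearrange′ = solve-∀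

module _ {m n : ℕ} .{{_ : NonZero m}} (m≤n : m ≤ n) where

  private
    b S : ℕ
    b = 2 + n / m
    S = suc (m / 2)

    b*S≤3n : b * S ≤ 3 * n
    b*S≤3n = ≤-trans (*-monoʳ-≤ b (1+m/2≤m m)) ([2+n/m]*m≤3n m n m≤n)

  exponent-bound : ∀ {L D} → S * L ≤ D * (m + b * S) + 2 * (D * (n + b * S)) → L * m ≤ D * (24 * n)
  exponent-bound {L} {D} count = begin
    L * m                                         ≤⟨ *-monoʳ-≤ L (m≤2*[1+m/2] m) ⟩
    L * (2 * S)                                   ≡⟨ rearrange L S ⟩
    2 * (S * L)                                   ≤⟨ *-monoʳ-≤ 2 count ⟩
    2 * (D * (m + b * S) + 2 * (D * (n + b * S))) ≤⟨ *-monoʳ-≤ 2 (+-mono-≤ (*-monoʳ-≤ D (+-mono-≤ m≤n b*S≤3n))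
                                                                        (*-monoʳ-≤ 2 (*-monoʳ-≤ D (+-monoʳ-≤ n b*S≤3n)))) ⟩
    2 * (D * (n + 3 * n) + 2 * (D * (n + 3 * n))) ≡⟨ rearrange′ D n ⟩
    D * (24 * n)                                  ∎
    where
      open ≤-Reasoning
      rearrange : ∀ L S → L * (2 * S) ≡ 2 * (S * L)
      rearrange = solve-∀
      rearrange′ : ∀ D n → 2 * (D * (n + 3 * n) + 2 * (D * (n + 3 * n))) ≡ D * (24 * n)
      rearrange′ = solve-∀

  base-power-bound : ∀ {e} → 2 ≤ n → b ^ e ≤ n → b ^ suc e ≤ n ^ 3
  base-power-bound {e} 2≤n b^e≤n = begin
    b * b ^ e          ≤⟨ *-mono-≤ (≤-trans (+-monoʳ-≤ 2 (m/n≤m n m)) (2+n≤n*n 2≤n)) b^e≤n ⟩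
    n * n * n          ≡⟨ rearrange n ⟩
    n * (n * (n * 1))  ∎
    where
      open ≤-Reasoning
      rearrange : ∀ n → n * n * n ≡ n * (n * (n * 1))
      rearrange = solve-∀

  size-bound : ∀ {L e} → 2 ≤ n → b ^ e ≤ n →
               S * L ≤ suc e * (m + b * S) + 2 * (suc e * (n + b * S)) →
               (m + n) ^ (L * m) ≤ m ^ (L * m) * n ^ (72 * n)
  size-bound {L} {e} 2≤n b^e≤n count = begin
    (m + n) ^ (L * m)            ≤⟨ ^-monoˡ-≤ (L * m) (m+n≤m*[2+n/m] m n) ⟩
    (m * b) ^ (L * m)            ≡⟨ ^-distribʳ-* m b (L * m) ⟩
    m ^ (L * m) * b ^ (L * m)    ≤⟨ *-monoʳ-≤ (m ^ (L * m)) b^[L*m]≤n^[72n] ⟩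
    m ^ (L * m) * n ^ (72 * n)   ∎
    where
      open ≤-Reasoning
      b^[L*m]≤n^[72n] : b ^ (L * m) ≤ n ^ (72 * n)
      b^[L*m]≤n^[72n] = begin
        b ^ (L * m)                  ≤⟨ ^-monoʳ-≤ b (exponent-bound {L} {suc e} count) ⟩
        b ^ (suc e * (24 * n))       ≡⟨ ^-*-assoc b (suc e) (24 * n) ⟨
        (b ^ suc e) ^ (24 * n)       ≤⟨ ^-monoˡ-≤ (24 * n) (base-power-bound {e} 2≤n b^e≤n) ⟩
        (n ^ 3) ^ (24 * n)           ≡⟨ ^-*-assoc n 3 (24 * n) ⟩
        n ^ (3 * (24 * n))           ≡⟨ cong (n ^_) (*-assoc 3 24 n) ⟨
        n ^ (72 * n)                 ∎

m≤n∧4≤m+n⇒2≤n : ∀ {m n} → m ≤ n → 4 ≤ m + n → 2 ≤ n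
m≤n∧4≤m+n⇒2≤n {n = suc (suc _)} _         _              = s≤s (s≤s z≤n)
m≤n∧4≤m+n⇒2≤n {n = zero}        z≤n       ()
m≤n∧4≤m+n⇒2≤n {n = suc zero}    z≤n       (s≤s ())
m≤n∧4≤m+n⇒2≤n {n = suc zero}    (s≤s z≤n) (s≤s (s≤s ()))

K-separatingPathSystem : ∀ {m n} .{{_ : NonZero m}} → m ≤ n → 2 ≤ n →
  ∃ λ 𝒫 → IsSeparatingPathSystem (K m n) 𝒫 × (m + n) ^ (length 𝒫 * m) ≤ m ^ (length 𝒫 * m) * n ^ (72 * n)
K-separatingPathSystem {m} {n@(suc _)} m≤n 2≤n
  with e , b^e≤n , n≤b^[1+e] ← power-bracket (2 + n / m) (s≤s (s≤s z≤n)) n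
  with 𝒫 , system , count ← Construction.separatingPathSystem m n (2 + n / m) (m / 2) (suc e)
                                (m/2+m/2≤m m) m≤n n≤b^[1+e] (s≤s z≤n)
  = 𝒫 , system , size-bound m≤n {e = e} 2≤n b^e≤n count

proposition3 : ∃ λ (C : ℕ) → ∀ (m n : ℕ) → 0 < m → m ≤ n → 4 ≤ m + n →
    ∃ λ (𝒫 : List (List (V (K m n)))) →
      IsSeparatingPathSystem (K m n) 𝒫
      × (m + n) ^ (length 𝒫 * m) ≤ (m ^ (length 𝒫 * m)) * (n ^ (C * n))
proposition3 = 72 , λ { (suc m) n _ m≤n 4≤m+n → K-separatingPathSystem m≤n (m≤n∧4≤m+n⇒2≤n m≤n 4≤m+n) }
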